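{- Let $\mathcal{R}$ be a rewrite system on a set $\mathcal{F}$ of symbols and $t\in\mathcal{T}(\mathcal{F},\mathcal{X}\cup\mathcal{X}_A)$. Then for every rule $l\rightarrow r$, $l\rightarrow r\in\mathcal{U}(t)$ implies $\mathcal{U}(r)\subseteq\mathcal{U}(t)$.
   Context: $\mathcal{X}$ is a set of variables and $\mathcal{X}_A$ a set of "abstraction variables" disjoint from $\mathcal{X}$; rules $l\rightarrow r$ satisfy $\mathrm{Var}(r)\subseteq\mathrm{Var}(l)$ and have variables in $\mathcal{X}$. For $f\in\mathcal{F}$, $Rls(f)=\{l\rightarrow r\in\mathcal{R}\mid \text{the top symbol of } l \text{ is } f\}$. The usable rules $\mathcal{U}(t)$ are defined by: $\mathcal{U}(t)=\mathcal{R}$ if $t\in\mathcal{X}$; $\mathcal{U}(t)=\emptyset$ if $t\in\mathcal{X}_A$; $\mathcal{U}(f(u_1,\ldots,u_n))=Rls(f)\cup\bigcup_{i=1}^n\mathcal{U}(u_i)\cup\bigcup_{l\rightarrow r\in Rls(f)}\mathcal{U}(r)$. -}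

module Defs where

open import Level using (Level; _⊔_; suc)
open import Data.Nat using (ℕ)
open import Data.Fin using (Fin)
open import Data.Product using (Σ; ∃; _×_; _,_)
open import Relation.Unary using (Pred)
open import Relation.Binary.PropositionalEquality using (_≡_)

record Signature : Set₁ where
  field
    Sym   : Set
    arity : Sym → ℕ
open Signature public

-- Terms T(F, X ∪ X_A): X ordinary variables, XA abstraction variables
-- (disjoint by construction, as separate constructors).
data Term (Σ' : Signature) (X XA : Set) : Set where
  var  : X → Term Σ' X XA
  avar : XA → Term Σ' X XA
  fun  : (f : Sym Σ') → (Fin (arity Σ' f) → Term Σ' X XA) → Term Σ' X XA

module _ {Σ' : Signature} {X XA : Set} where

  data _occurs-in_ (x : X) : Term Σ' X XA → Set where
    here : x occurs-in var x
    arg  : ∀ {f us} (i : Fin (arity Σ' f)) → x occurs-in us i → x occurs-in fun f us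

  data NoAbsVar : Term Σ' X XA → Set where
    var : ∀ x → NoAbsVar (var x)
    fun : ∀ {f us} → (∀ i → NoAbsVar (us i)) → NoAbsVar (fun f us)

  TopIs : Term Σ' X XA → Sym Σ' → Set
  TopIs t f = ∃ λ us → t ≡ fun f us

record Rule (Σ' : Signature) (X XA : Set) : Set where
  constructor _⟶_
  field
    lhs : Term Σ' X XA
    rhs : Term Σ' X XA
open Rule public

module _ {Σ' : Signature} {X XA : Set} where

  WellFormedRule : Rule Σ' X XA → Set
  WellFormedRule ρ = NoAbsVar (lhs ρ) × NoAbsVar (rhs ρ)
                   × (∀ x → x occurs-in rhs ρ → x occurs-in lhs ρ)

  Rls : ∀ {ℓ} → Pred (Rule Σ' X XA) ℓ → Sym Σ' → Pred (Rule Σ' X XA) ℓ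
  Rls R f ρ = R ρ × TopIs (lhs ρ) f

  -- Usable rules U(t), as the least set satisfying the defining equations:
  --   U(x) = R (x ∈ X), U(α) = ∅ (α ∈ X_A),
  --   U(f(u₁..uₙ)) = Rls(f) ∪ ⋃ U(uᵢ) ∪ ⋃_{l→r ∈ Rls(f)} U(r).
  data U {ℓ} (R : Pred (Rule Σ' X XA) ℓ) : Term Σ' X XA → Pred (Rule Σ' X XA) ℓ where
    inVar : ∀ {x ρ} → R ρ → U R (var x) ρ
    inRls : ∀ {f us ρ} → Rls R f ρ → U R (fun f us) ρ
    inArg : ∀ {f us ρ} (i : Fin (arity Σ' f)) → U R (us i) ρ → U R (fun f us) ρ
    inRhs : ∀ {f us ρ} ρ' → Rls R f ρ' → U R (rhs ρ') ρ → U R (fun f us) ρ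

{-# OPTIONS --safe #-}
module Submission where

open import Defs
open import Data.Product using (_,_)
open import Relation.Unary using (Pred; _⊆_)

-- Induction on the derivation of l → r ∈ U(t). At a variable, U(t) = R already
-- contains every usable rule; when l → r ∈ Rls(f), U(r) is one of the sets
-- whose union is U(f(u₁,…,uₙ)).

module _ {ℓ} {Σ' : Signature} {X XA : Set} (R : Pred (Rule Σ' X XA) ℓ) where

  U⊆R : ∀ t → U R t ⊆ R
  U⊆R _ (inVar ρ∈R)        = ρ∈R
  U⊆R _ (inRls (ρ∈R , _))  = ρ∈R
  U⊆R _ (inArg _ ρ∈U)      = U⊆R _ ρ∈U
  U⊆R _ (inRhs _ _ ρ∈U)    = U⊆R _ ρ∈U

  U-rhs-closed : ∀ {t ρ} → U R t ρ → U R (rhs ρ) ⊆ U R t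
  U-rhs-closed (inVar _)         σ∈U = inVar (U⊆R _ σ∈U)
  U-rhs-closed (inRls ρ∈Rls)     σ∈U = inRhs _ ρ∈Rls σ∈U
  U-rhs-closed (inArg i ρ∈U)     σ∈U = inArg i (U-rhs-closed ρ∈U σ∈U)
  U-rhs-closed (inRhs ρ' p ρ∈U)  σ∈U = inRhs ρ' p (U-rhs-closed ρ∈U σ∈U)

lemmaC2 : ∀ {ℓ} (Σ' : Signature) (X XA : Set) (R : Pred (Rule Σ' X XA) ℓ)
    → (∀ ρ → R ρ → WellFormedRule ρ)
    → (t : Term Σ' X XA) (ρ : Rule Σ' X XA)
    → U R t ρ → U R (rhs ρ) ⊆ U R t
lemmaC2 _ _ _ R _ _ _ = U-rhs-closed R
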